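{- Let $\Delta<0$ be a discriminant, $p$ a prime, and let $(A,B,C)\in \mathrm{CL}(\Delta p^2)$. Let $(a,b,c)\in\mathrm{CL}(\Delta)$ be a class with $(A,B,C)\in\Psi_p(a,b,c)$. Then $$P_{p,0}(A,B,C,q)=(a,b,c,q^{p^2}).$$
   Context: $(a,b,c)$ denotes the $SL(2,\mathbb{Z})$-equivalence class of the form $ax^2+bxy+cy^2$; we consider only $\Delta=b^2-4ac<0$, $a>0$. $\mathrm{CL}(\Delta)$ is the set of classes of primitive ($\gcd(a,b,c)=1$) forms of discriminant $\Delta$. For $(a,b,c)\in\mathrm{CL}(\Delta)$, $\Psi_p(a,b,c)$ is the set of distinct primitive classes occurring in the list $\{(a,bp,cp^2)\}\cup\{(ap^2,pb+2ahp,ah^2+bh+c):0\le h<p\}$ of forms of discriminant $\Delta p^2$; the sets $\Psi_p(a,b,c)$, $(a,b,c)\in\mathrm{CL}(\Delta)$, partition $\mathrm{CL}(\Delta p^2)$. The theta series is $(a,b,c,q):=\sum_{(x,y)\in\mathbb{Z}^2}q^{ax^2+bxy+cy^2}$ (which depends only on the class). For $0\le r<m$, $P_{m,r}\sum_{n\ge0}a(n)q^n=\sum_{n\ge0}a(mn+r)q^{mn+r}$. -}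

module Defs where

open import Data.Nat as ℕ using (ℕ; zero; suc; NonZero)
open import Data.Nat.DivMod using (_%_; _/_)
open import Data.Nat.Divisibility using (_∣?_)
open import Data.Integer as ℤ using (ℤ; +_; _+_; _-_; _*_; ∣_∣)
open import Data.Integer.GCD using (gcd)
open import Data.List using (List; _∷_; []; map; upTo; filter; length; concatMap)
open import Data.List.Membership.Propositional using (_∈_)
open import Data.Product using (Σ; ∃; _×_; _,_)
open import Relation.Binary.PropositionalEquality using (_≡_)
open import Relation.Nullary.Decidable using (does)
open import Data.Bool using (if_then_else_)

record Form : Set where
  constructor form
  field
    a b c : ℤ
open Form public

disc : Form → ℤ
disc (form a b c) = b * b - (+ 4) * a * c

eval : Form → ℤ → ℤ → ℤ
eval (form a b c) x y = a * x * x + b * x * y + c * y * y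

Primitive : Form → Set
Primitive (form a b c) = gcd (gcd a b) c ≡ + 1

_~_ : Form → Form → Set
F ~ G = Σ ℤ λ α → Σ ℤ λ β → Σ ℤ λ γ → Σ ℤ λ δ →
        (α * δ - β * γ ≡ + 1) ×
        (∀ x y → eval F (α * x + β * y) (γ * x + δ * y) ≡ eval G x y)

psiList : ℕ → Form → List Form
psiList p (form a b c) =
  form a (b * P) (c * P * P) ∷
  map (λ h → let H = + h in
         form (a * P * P) (P * b + (+ 2) * a * H * P) (a * H * H + b * H + c))
      (upTo p)
  where P = + p

-- (A,B,C) ∈ Ψ_p(a,b,c): the class of G is a primitive class occurring in
-- the list psiList p F (membership of classes = SL(2,ℤ)-equivalence to a listed form).
InPsi : ℕ → Form → Form → Set
InPsi p F G = Primitive G × Σ Form λ H → (H ∈ psiList p F) × (H ~ G)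

-- Formal power series with ℕ coefficients: n ↦ coefficient of q^n.
Series : Set
Series = ℕ → ℕ

box : ℕ → List ℤ
box R = map (λ i → + i - + R) (upTo (suc (2 ℕ.* R)))

-- All solutions lie in the box
-- |x|,|y| ≤ 4(|a|+|c|)n (since 4aF = (2ax+by)² + |Δ|y², and symmetrically),
-- so counting in that box counts all of ℤ².
thetaCoeff : Form → ℕ → ℕ
thetaCoeff F n =
  length (filter (λ xy → eval F (fst xy) (snd xy) ℤ.≟ + n)
    (concatMap (λ x → map (λ y → x , y) (box R)) (box R)))
  where
  R = 4 ℕ.* (∣ a F ∣ ℕ.+ ∣ c F ∣) ℕ.* n
  fst : ℤ × ℤ → ℤ
  fst (x , _) = x
  snd : ℤ × ℤ → ℤ
  snd (_ , y) = y

theta : Form → Series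
theta = thetaCoeff

Pop : (m r : ℕ) → .{{NonZero m}} → Series → Series
Pop m r s n = if does ((n % m) ℕ.≟ r) then s n else 0

subQ : (k : ℕ) → .{{NonZero k}} → Series → Series
subQ k s n = if does (k ∣? n) then s (n / k) else 0

{-# OPTIONS --safe #-}
module Submission where

-- Each form H
-- in psiList p F is F precomposed with an integral matrix of determinant p, so its adjugate gives
-- an injective ι : ℤ² → ℤ² with H(ι z) = p² F(z).  Moreover ι(ℤ²) is the set of w with p ∣ H(w):
-- modulo p, H(u, v) is K u² or K v² with p ∤ K, since otherwise p would divide every value of H,
-- hence of the primitive form G ~ H.  Transported along G ~ H, ι maps the solutions of F(z) = m
-- bijectively onto those of G(w) = p² m, and G(w) = n has no solution when p ∣ n but p² ∤ n.

open import Defs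

module Representation where

  open import Data.Bool using (if_then_else_)
  open import Data.Empty using (⊥-elim)
  open import Data.Integer
    using (ℤ; +_; -[1+_]; +[1+_]; 0ℤ; ∣_∣; _+_; _-_; _*_; -_; _<_; _≟_; +<+; -<+)
  import Data.Integer as ℤ using (NonZero)
  open import Data.Integer.Divisibility.Signed
    using (_∣_; divides; ∣ᵤ⇒∣; ∣⇒∣ᵤ; ∣-refl; ∣m⇒∣m*n; ∣m∣n⇒∣m+n; ∣m+n∣m⇒∣n; ∣m+n∣n⇒∣m)
  open import Data.Integer.GCD using (gcd; gcd-greatest)
  open import Data.Integer.Properties
    using (pos-+; pos-*; abs-*; +-injective; *-identityˡ; *-comm; *-cancelˡ-≡; i*j≢0)
  open import Data.Integer.Tactic.RingSolver using (solve-∀)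
  open import Data.List using (List; []; _∷_; _++_; map; filter; length; concatMap; cartesianProduct)
  open import Data.List.Membership.Propositional using (_∈_)
  open import Data.List.Membership.Propositional.Properties
    using (∈-map⁺; ∈-map⁻; ∈-upTo⁺; ∈-filter⁺; ∈-filter⁻; ∈-cartesianProduct⁺)
  open import Data.List.Membership.Propositional.Properties.WithK using (unique∧set⇒bag)
  open import Data.List.Properties using (length-map; filter-none)
  open import Data.List.Relation.Binary.BagAndSetEquality using (∼bag⇒↭)
  open import Data.List.Relation.Binary.Permutation.Propositional.Properties using (↭-length)
  open import Data.List.Relation.Unary.All using (universal)
  open import Data.List.Relation.Unary.Any using (here; there)
  open import Data.List.Relation.Unary.Unique.Propositional using (Unique)
  import Data.List.Relation.Unary.Unique.Propositional.Properties as Unique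
  open import Data.Nat as ℕ using (ℕ; zero; suc; NonZero)
  open import Data.Nat.DivMod using (_%_; _/_; m*n/n≡m)
  import Data.Nat.Divisibility as ℕᵈ
  open import Data.Nat.Primality using (Prime; prime⇒nonZero; euclidsLemma; ¬prime[1])
  import Data.Nat.Properties as ℕₚ
  open import Data.Product using (Σ; _×_; _,_; proj₁; proj₂; ∃)
  open import Data.Product.Properties using (,-injective)
  open import Data.Sum using (_⊎_; inj₁; inj₂)
  import Data.Sum as Sum
  open import Function.Base using (_∘_)
  open import Function.Bundles using (mk⇔; Inverse; _↔_; mk↔ₛ′)
  open import Function.Definitions using (Injective)
  open import Relation.Binary.PropositionalEquality
    using (_≡_; _≢_; refl; sym; trans; cong; cong₂; subst; module ≡-Reasoning)
  open import Relation.Nullary using (¬_; Dec; does; yes; no)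

  ℤ² : Set
  ℤ² = ℤ × ℤ

  _⟦_⟧ : Form → ℤ² → ℤ
  F ⟦ x , y ⟧ = eval F x y

  swap : Form → Form
  swap (form a b c) = form c b a

  eval-swap : ∀ F x y → eval (swap F) y x ≡ eval F x y
  eval-swap (form a b c) = identity a b c
    where
    identity : ∀ a b c x y → c * y * y + b * y * x + a * x * x ≡ a * x * x + b * x * y + c * y * y
    identity = solve-∀

  disc-swap : ∀ F → disc (swap F) ≡ disc F
  disc-swap (form a b c) = identity a b c
    where
    identity : ∀ a b c → b * b - + 4 * c * a ≡ b * b - + 4 * a * c
    identity = solve-∀

  complete-square : ∀ a b c x y →
    + 4 * c * (a * x * x + b * x * y + c * y * y) ≡
    (+ 2 * c * y + b * x) * (+ 2 * c * y + b * x) + (- (b * b - + 4 * a * c)) * (x * x)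
  complete-square = solve-∀

  i*i≡+∣i∣*∣i∣ : ∀ i → i * i ≡ + (∣ i ∣ ℕ.* ∣ i ∣)
  i*i≡+∣i∣*∣i∣ (+ zero)  = refl
  i*i≡+∣i∣*∣i∣ (+ suc m) = refl
  i*i≡+∣i∣*∣i∣ -[1+ m ]  = refl

  ∣i∣≤∣j*j-Δ*[i*i]∣ : ∀ {Δ} i j → Δ < 0ℤ → ∣ i ∣ ℕ.≤ ∣ j * j + (- Δ) * (i * i) ∣
  ∣i∣≤∣j*j-Δ*[i*i]∣ {+ _}      i j (+<+ ())
  ∣i∣≤∣j*j-Δ*[i*i]∣ { -[1+ k ]} i j _ = begin
    ∣ i ∣                                          ≤⟨ m≤m*m ∣ i ∣ ⟩
    ∣ i ∣ ℕ.* ∣ i ∣                                 ≤⟨ ℕₚ.m≤n*m _ (suc k) ⟩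
    suc k ℕ.* (∣ i ∣ ℕ.* ∣ i ∣)                     ≤⟨ ℕₚ.m≤n+m _ (∣ j ∣ ℕ.* ∣ j ∣) ⟩
    ∣ j ∣ ℕ.* ∣ j ∣ ℕ.+ suc k ℕ.* (∣ i ∣ ℕ.* ∣ i ∣) ≡⟨ cong ∣_∣ as-ℕ ⟨
    ∣ j * j + +[1+ k ] * (i * i) ∣                  ∎
    where
    open ℕₚ.≤-Reasoning
    m≤m*m : ∀ m → m ℕ.≤ m ℕ.* m
    m≤m*m zero    = ℕ.z≤n
    m≤m*m (suc m) = ℕₚ.m≤m*n (suc m) (suc m)
    as-ℕ : j * j + +[1+ k ] * (i * i) ≡ + (∣ j ∣ ℕ.* ∣ j ∣ ℕ.+ suc k ℕ.* (∣ i ∣ ℕ.* ∣ i ∣))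
    as-ℕ = trans (cong₂ (λ u v → u + +[1+ k ] * v) (i*i≡+∣i∣*∣i∣ j) (i*i≡+∣i∣*∣i∣ i))
             (trans (cong (_+_ (+ (∣ j ∣ ℕ.* ∣ j ∣))) (sym (pos-* (suc k) (∣ i ∣ ℕ.* ∣ i ∣))))
                    (sym (pos-+ (∣ j ∣ ℕ.* ∣ j ∣) _)))

  i<0⇒i*+n<0 : ∀ {i} n .{{_ : NonZero n}} → i < 0ℤ → i * + n < 0ℤ
  i<0⇒i*+n<0 {+ _}      _       (+<+ ())
  i<0⇒i*+n<0 { -[1+ _ ]} (suc _) _ = -<+

  ∣x∣≤4∣c∣n : ∀ F {x y n} → disc F < 0ℤ → eval F x y ≡ + n → ∣ x ∣ ℕ.≤ 4 ℕ.* ∣ c F ∣ ℕ.* n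
  ∣x∣≤4∣c∣n (form a b c) {x} {y} {n} Δ<0 F[x,y]≡n = begin
    ∣ x ∣                                           ≤⟨ ∣i∣≤∣j*j-Δ*[i*i]∣ x S Δ<0 ⟩
    ∣ S * S + (- (b * b - + 4 * a * c)) * (x * x) ∣ ≡⟨ cong ∣_∣ (complete-square a b c x y) ⟨
    ∣ + 4 * c * eval (form a b c) x y ∣             ≡⟨ cong (λ v → ∣ + 4 * c * v ∣) F[x,y]≡n ⟩
    ∣ + 4 * c * + n ∣                               ≡⟨ abs-* (+ 4 * c) (+ n) ⟩
    ∣ + 4 * c ∣ ℕ.* n                               ≡⟨ cong (ℕ._* n) (abs-* (+ 4) c) ⟩
    4 ℕ.* ∣ c ∣ ℕ.* n                               ∎
    where
    open ℕₚ.≤-Reasoning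
    S = + 2 * c * y + b * x

  radius : Form → ℕ → ℕ
  radius F n = 4 ℕ.* (∣ a F ∣ ℕ.+ ∣ c F ∣) ℕ.* n

  solution-bounded : ∀ F {x y n} → disc F < 0ℤ → eval F x y ≡ + n →
    ∣ x ∣ ℕ.≤ radius F n × ∣ y ∣ ℕ.≤ radius F n
  solution-bounded F@(form a b c) {x} {y} {n} Δ<0 F[x,y]≡n =
    ℕₚ.≤-trans (∣x∣≤4∣c∣n F Δ<0 F[x,y]≡n) (scale (ℕₚ.m≤n+m ∣ c ∣ ∣ a ∣)) ,
    ℕₚ.≤-trans (∣x∣≤4∣c∣n (swap F) swapΔ<0 (trans (eval-swap F x y) F[x,y]≡n))
               (scale (ℕₚ.m≤m+n ∣ a ∣ ∣ c ∣))
    where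
    scale : ∀ {m} → m ℕ.≤ ∣ a ∣ ℕ.+ ∣ c ∣ → 4 ℕ.* m ℕ.* n ℕ.≤ radius F n
    scale m≤ = ℕₚ.*-monoˡ-≤ n (ℕₚ.*-monoʳ-≤ 4 m≤)
    swapΔ<0 : disc (swap F) < 0ℤ
    swapΔ<0 = subst (_< 0ℤ) (sym (disc-swap F)) Δ<0

  box-unique : ∀ R → Unique (box R)
  box-unique R = Unique.map⁺ cancel-R (Unique.upTo⁺ _)
    where
    [i-R]+R≡i : ∀ i R → i - R + R ≡ i
    [i-R]+R≡i = solve-∀
    cancel-R : ∀ {i j} → + i - + R ≡ + j - + R → i ≡ j
    cancel-R {i} {j} eq = +-injective
      (trans (sym ([i-R]+R≡i (+ i) (+ R))) (trans (cong (_+ + R) eq) ([i-R]+R≡i (+ j) (+ R))))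

  ∈-box : ∀ {R} x → ∣ x ∣ ℕ.≤ R → x ∈ box R
  ∈-box {R} (+ k) k≤R = subst (_∈ box R) shift (∈-map⁺ _ (∈-upTo⁺ (ℕ.s≤s k+R≤2R)))
    where
    k+R≤2R : k ℕ.+ R ℕ.≤ 2 ℕ.* R
    k+R≤2R = ℕₚ.≤-trans (ℕₚ.+-monoˡ-≤ R k≤R) (ℕₚ.+-monoʳ-≤ R (ℕₚ.m≤m+n R 0))
    [i+R]-R≡i : ∀ i R → i + R - R ≡ i
    [i+R]-R≡i = solve-∀
    shift : + (k ℕ.+ R) - + R ≡ + k
    shift = trans (cong (_- + R) (pos-+ k R)) ([i+R]-R≡i (+ k) (+ R))
  ∈-box {R} -[1+ k ] 1+k≤R with ℕₚ.m≤n⇒∃[o]m+o≡n 1+k≤R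
  ... | j , refl = subst (_∈ box R) shift (∈-map⁺ _ (∈-upTo⁺ (ℕ.s≤s j≤2R)))
    where
    j≤2R : j ℕ.≤ 2 ℕ.* R
    j≤2R = ℕₚ.≤-trans (ℕₚ.m≤n+m j (suc k)) (ℕₚ.m≤m+n R _)
    j-[i+j]≡-i : ∀ i j → j - (i + j) ≡ - i
    j-[i+j]≡-i = solve-∀
    shift : + j - + (suc k ℕ.+ j) ≡ -[1+ k ]
    shift = trans (cong (_-_ (+ j)) (pos-+ (suc k) j)) (j-[i+j]≡-i (+ suc k) (+ j))

  solutions : Form → ℕ → List ℤ²
  solutions F n = filter (λ z → F ⟦ z ⟧ ≟ + n) (cartesianProduct (box R) (box R))
    where R = radius F n

  concatMap-pairs≡cartesianProduct : ∀ {A B : Set} (xs : List A) (ys : List B) →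
    concatMap (λ x → map (x ,_) ys) xs ≡ cartesianProduct xs ys
  concatMap-pairs≡cartesianProduct []       ys = refl
  concatMap-pairs≡cartesianProduct (x ∷ xs) ys =
    cong (map (x ,_) ys ++_) (concatMap-pairs≡cartesianProduct xs ys)

  theta≡length-solutions : ∀ F n → theta F n ≡ length (solutions F n)
  theta≡length-solutions F n =
    cong (λ zs → length (filter (λ z → F ⟦ z ⟧ ≟ + n) zs))
         (concatMap-pairs≡cartesianProduct (box (radius F n)) (box (radius F n)))

  solutions-unique : ∀ F n → Unique (solutions F n)
  solutions-unique F n = Unique.filter⁺ (λ z → F ⟦ z ⟧ ≟ + n)
    (Unique.cartesianProduct⁺ (box-unique (radius F n)) (box-unique (radius F n)))

  ∈-solutions⁻ : ∀ F {n z} → z ∈ solutions F n → F ⟦ z ⟧ ≡ + n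
  ∈-solutions⁻ F {n} z∈ = proj₂ (∈-filter⁻ (λ z → F ⟦ z ⟧ ≟ + n) z∈)

  ∈-solutions⁺ : ∀ F {n} z → disc F < 0ℤ → F ⟦ z ⟧ ≡ + n → z ∈ solutions F n
  ∈-solutions⁺ F {n} (x , y) Δ<0 F[z]≡n =
    ∈-filter⁺ (λ z → F ⟦ z ⟧ ≟ + n)
      (∈-cartesianProduct⁺ (∈-box x (proj₁ bounded)) (∈-box y (proj₂ bounded))) F[z]≡n
    where bounded = solution-bounded F Δ<0 F[z]≡n

  unique∧set⇒length≡ : ∀ {A : Set} {xs ys : List A} → Unique xs → Unique ys →
    (∀ {z} → z ∈ xs → z ∈ ys) → (∀ {z} → z ∈ ys → z ∈ xs) → length xs ≡ length ys
  unique∧set⇒length≡ xs! ys! ⊆ ⊇ = ↭-length (∼bag⇒↭ (unique∧set⇒bag xs! ys! (mk⇔ ⊆ ⊇)))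

  theta-≡-bijection : ∀ {F G m n} → disc F < 0ℤ → disc G < 0ℤ →
    (ι : ℤ² → ℤ²) → Injective _≡_ _≡_ ι →
    (∀ z → F ⟦ z ⟧ ≡ + m → G ⟦ ι z ⟧ ≡ + n) →
    (∀ w → G ⟦ w ⟧ ≡ + n → ∃ λ z → F ⟦ z ⟧ ≡ + m × ι z ≡ w) →
    theta G n ≡ theta F m
  theta-≡-bijection {F} {G} {m} {n} ΔF<0 ΔG<0 ι ι-injective ι-solution ι-onto = begin
    theta G n                      ≡⟨ theta≡length-solutions G n ⟩
    length (solutions G n)         ≡⟨ unique∧set⇒length≡ (solutions-unique G n) ι-unique ⊆ ⊇ ⟩
    length (map ι (solutions F m)) ≡⟨ length-map ι (solutions F m) ⟩
    length (solutions F m)         ≡⟨ theta≡length-solutions F m ⟨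
    theta F m                      ∎
    where
    open ≡-Reasoning
    ι-unique : Unique (map ι (solutions F m))
    ι-unique = Unique.map⁺ ι-injective (solutions-unique F m)
    ⊆ : ∀ {w} → w ∈ solutions G n → w ∈ map ι (solutions F m)
    ⊆ {w} w∈ with ι-onto w (∈-solutions⁻ G w∈)
    ... | z , F[z]≡m , refl = ∈-map⁺ ι (∈-solutions⁺ F z ΔF<0 F[z]≡m)
    ⊇ : ∀ {w} → w ∈ map ι (solutions F m) → w ∈ solutions G n
    ⊇ w∈ with ∈-map⁻ ι w∈
    ... | z , z∈ , refl = ∈-solutions⁺ G (ι z) ΔG<0 (ι-solution z (∈-solutions⁻ F z∈))

  theta≡0 : ∀ {G n} → (∀ z → G ⟦ z ⟧ ≢ + n) → theta G n ≡ 0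
  theta≡0 {G} {n} no-solution = trans (theta≡length-solutions G n)
    (cong length (filter-none (λ z → G ⟦ z ⟧ ≟ + n) (universal no-solution grid)))
    where grid = cartesianProduct (box (radius G n)) (box (radius G n))

  record ScaledEmbedding (p : ℕ) (F G : Form) : Set where
    field
      ι         : ℤ² → ℤ²
      injective : Injective _≡_ _≡_ ι
      scales    : ∀ z → G ⟦ ι z ⟧ ≡ + p * + p * F ⟦ z ⟧
      covers-p∣ : ∀ w → + p ∣ G ⟦ w ⟧ → ∃ λ z → ι z ≡ w

  module _ {p F G} (E : ScaledEmbedding p F G) where
    open ScaledEmbedding E

    theta-scaled : .{{NonZero p}} → disc F < 0ℤ → disc G < 0ℤ →
      ∀ m → theta G (p ℕ.* p ℕ.* m) ≡ theta F m
    theta-scaled ΔF<0 ΔG<0 m =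
      theta-≡-bijection {F} {G} ΔF<0 ΔG<0 ι injective scaled-solution scaled-solution⁻¹
      where
      instance
        p²≢0 : ℤ.NonZero (+ p * + p)
        p²≢0 = i*j≢0 (+ p) (+ p)
      p²m : + p * + p * + m ≡ + (p ℕ.* p ℕ.* m)
      p²m = sym (trans (pos-* (p ℕ.* p) m) (cong (_* + m) (pos-* p p)))
      p∣p²m : + p ∣ + (p ℕ.* p ℕ.* m)
      p∣p²m = ∣ᵤ⇒∣ (ℕᵈ.∣-trans (ℕᵈ.m∣m*n p) (ℕᵈ.m∣m*n m))
      scaled-solution : ∀ z → F ⟦ z ⟧ ≡ + m → G ⟦ ι z ⟧ ≡ + (p ℕ.* p ℕ.* m)
      scaled-solution z F[z]≡m = trans (scales z) (trans (cong (+ p * + p *_) F[z]≡m) p²m)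
      scaled-solution⁻¹ : ∀ w → G ⟦ w ⟧ ≡ + (p ℕ.* p ℕ.* m) → ∃ λ z → F ⟦ z ⟧ ≡ + m × ι z ≡ w
      scaled-solution⁻¹ w G[w]≡p²m with covers-p∣ w (subst (+ p ∣_) (sym G[w]≡p²m) p∣p²m)
      ... | z , refl =
        z , *-cancelˡ-≡ (+ p * + p) _ _ (trans (sym (scales z)) (trans G[w]≡p²m (sym p²m))) , refl

    theta-vanishes : ∀ {n} → p ℕᵈ.∣ n → ¬ (p ℕ.* p ℕᵈ.∣ n) → theta G n ≡ 0
    theta-vanishes {n} p∣n p²∤n = theta≡0 {G} no-solution
      where
      no-solution : ∀ w → G ⟦ w ⟧ ≢ + n
      no-solution w G[w]≡n with covers-p∣ w (subst (+ p ∣_) (sym G[w]≡n) (∣ᵤ⇒∣ p∣n))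
      ... | z , refl = p²∤n (ℕᵈ.divides ∣ F ⟦ z ⟧ ∣ (trans n≡p²∣F[z]∣ (ℕₚ.*-comm (p ℕ.* p) _)))
        where
        n≡p²∣F[z]∣ : n ≡ p ℕ.* p ℕ.* ∣ F ⟦ z ⟧ ∣
        n≡p²∣F[z]∣ = trans (cong ∣_∣ (trans (sym G[w]≡n) (scales z)))
                           (trans (abs-* (+ p * + p) _) (cong (ℕ._* ∣ F ⟦ z ⟧ ∣) (abs-* (+ p) (+ p))))

    Pop-theta≡subQ-theta : .{{_ : NonZero p}} → disc F < 0ℤ → disc G < 0ℤ →
      ∀ n → Pop p 0 (theta G) n ≡ subQ (p ℕ.* p) {{ℕₚ.m*n≢0 p p}} (theta F) n
    Pop-theta≡subQ-theta ΔF<0 ΔG<0 n = by-cases (n % p ℕ.≟ 0) (p ℕ.* p ℕᵈ.∣? n)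
      where
      instance
        p²≢0 : NonZero (p ℕ.* p)
        p²≢0 = ℕₚ.m*n≢0 p p
      -- Pop and subQ test does (_ ≟ _), which computes to a boolean, so a with cannot abstract
      -- these decisions; they are taken as arguments instead.
      by-cases : (p∣n? : Dec (n % p ≡ 0)) (p²∣n? : Dec (p ℕ.* p ℕᵈ.∣ n)) →
        (if does p∣n? then theta G n else 0) ≡ (if does p²∣n? then theta F (n / (p ℕ.* p)) else 0)
      by-cases (yes _)       (yes (ℕᵈ.divides m n≡m*p²)) = begin
        theta G n                             ≡⟨ cong (theta G) (trans n≡m*p² (ℕₚ.*-comm m (p ℕ.* p))) ⟩
        theta G (p ℕ.* p ℕ.* m)               ≡⟨ theta-scaled ΔF<0 ΔG<0 m ⟩
        theta F m                             ≡⟨ cong (theta F) (m*n/n≡m m (p ℕ.* p)) ⟨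
        theta F (m ℕ.* (p ℕ.* p) / (p ℕ.* p)) ≡⟨ cong (λ k → theta F (k / (p ℕ.* p))) n≡m*p² ⟨
        theta F (n / (p ℕ.* p))               ∎
        where open ≡-Reasoning
      by-cases (yes n%p≡0) (no p²∤n)  = theta-vanishes (ℕᵈ.m%n≡0⇒n∣m n p n%p≡0) p²∤n
      by-cases (no n%p≢0)  (yes p²∣n) = ⊥-elim (n%p≢0 (ℕᵈ.n∣m⇒m%n≡0 n p (ℕᵈ.∣-trans (ℕᵈ.m∣m*n p) p²∣n)))
      by-cases (no _)      (no _)     = refl

  ~⇒↔ : ∀ {H G} → H ~ G → Σ (ℤ² ↔ ℤ²) λ M → ∀ z → H ⟦ Inverse.to M z ⟧ ≡ G ⟦ z ⟧
  ~⇒↔ (α , β , γ , δ , det≡1 , H∘M≡G) = mk↔ₛ′ M adj M∘adj adj∘M , λ (x , y) → H∘M≡G x y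
    where
    M adj : ℤ² → ℤ²
    M (x , y) = α * x + β * y , γ * x + δ * y
    adj (u , v) = δ * u - β * v , - γ * u + α * v
    det* : ∀ i → (α * δ - β * γ) * i ≡ i
    det* i = trans (cong (_* i) det≡1) (*-identityˡ i)
    M∘adj : ∀ w → M (adj w) ≡ w
    M∘adj (u , v) =
      cong₂ _,_ (trans (identity₁ α β γ δ u v) (det* u)) (trans (identity₂ α β γ δ u v) (det* v))
      where
      identity₁ : ∀ α β γ δ u v → α * (δ * u - β * v) + β * (- γ * u + α * v) ≡ (α * δ - β * γ) * u
      identity₁ = solve-∀
      identity₂ : ∀ α β γ δ u v → γ * (δ * u - β * v) + δ * (- γ * u + α * v) ≡ (α * δ - β * γ) * v
      identity₂ = solve-∀
    adj∘M : ∀ z → adj (M z) ≡ z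
    adj∘M (x , y) =
      cong₂ _,_ (trans (identity₁ α β γ δ x y) (det* x)) (trans (identity₂ α β γ δ x y) (det* y))
      where
      identity₁ : ∀ α β γ δ x y → δ * (α * x + β * y) - β * (γ * x + δ * y) ≡ (α * δ - β * γ) * x
      identity₁ = solve-∀
      identity₂ : ∀ α β γ δ x y → - γ * (α * x + β * y) + α * (γ * x + δ * y) ≡ (α * δ - β * γ) * y
      identity₂ = solve-∀

  ScaledEmbedding-respʳ-~ : ∀ {p F H G} → ScaledEmbedding p F H → H ~ G → ScaledEmbedding p F G
  ScaledEmbedding-respʳ-~ {p} {F} {H} {G} E H~G = record
    { ι         = from ∘ ι
    ; injective = λ {z} {z′} eq → injective
        (trans (sym (strictlyInverseˡ (ι z))) (trans (cong to eq) (strictlyInverseˡ (ι z′))))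
    ; scales    = λ z → trans (sym (H∘to≡G (from (ι z))))
        (trans (cong (H ⟦_⟧) (strictlyInverseˡ (ι z))) (scales z))
    ; covers-p∣ = covers
    }
    where
    open ScaledEmbedding E
    open Inverse (proj₁ (~⇒↔ {H} {G} H~G))
    H∘to≡G = proj₂ (~⇒↔ {H} {G} H~G)
    covers : ∀ w → + p ∣ G ⟦ w ⟧ → ∃ λ z → from (ι z) ≡ w
    covers w p∣G[w] with covers-p∣ (to w) (subst (+ p ∣_) (sym (H∘to≡G w)) p∣G[w])
    ... | z , ιz≡to[w] = z , trans (cong from ιz≡to[w]) (strictlyInverseʳ w)

  DividesAllValues : ℕ → Form → Set
  DividesAllValues p H = ∀ z → + p ∣ H ⟦ z ⟧

  DividesAllValues-respʳ-~ : ∀ {p H G} → H ~ G → DividesAllValues p H → DividesAllValues p G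
  DividesAllValues-respʳ-~ {p} (α , β , γ , δ , _ , H∘M≡G) p∣H (x , y) =
    subst (+ p ∣_) (H∘M≡G x y) (p∣H (α * x + β * y , γ * x + δ * y))

  primitive⇒¬DividesAllValues : ∀ {p G} → Prime p → Primitive G → ¬ DividesAllValues p G
  primitive⇒¬DividesAllValues {p} {form A B C} p-prime gcd≡1 p∣G =
    ¬prime[1] (subst Prime (ℕᵈ.∣1⇒≡1 (subst (λ g → p ℕᵈ.∣ ∣ g ∣) gcd≡1 p∣gcd)) p-prime)
    where
    G[1,0]≡A : ∀ A B C → A * + 1 * + 1 + B * + 1 * + 0 + C * + 0 * + 0 ≡ A
    G[1,0]≡A = solve-∀
    G[0,1]≡C : ∀ A B C → A * + 0 * + 0 + B * + 0 * + 1 + C * + 1 * + 1 ≡ C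
    G[0,1]≡C = solve-∀
    G[1,1]≡A+B+C : ∀ A B C → A * + 1 * + 1 + B * + 1 * + 1 + C * + 1 * + 1 ≡ A + B + C
    G[1,1]≡A+B+C = solve-∀
    p∣A : + p ∣ A
    p∣A = subst (+ p ∣_) (G[1,0]≡A A B C) (p∣G (+ 1 , + 0))
    p∣C : + p ∣ C
    p∣C = subst (+ p ∣_) (G[0,1]≡C A B C) (p∣G (+ 0 , + 1))
    p∣B : + p ∣ B
    p∣B = ∣m+n∣m⇒∣n (∣m+n∣n⇒∣m (subst (+ p ∣_) (G[1,1]≡A+B+C A B C) (p∣G (+ 1 , + 1))) p∣C) p∣A
    p∣gcd : p ℕᵈ.∣ ∣ gcd (gcd A B) C ∣
    p∣gcd = gcd-greatest {gcd A B} {C} {+ p}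
      (gcd-greatest {A} {B} {+ p} (∣⇒∣ᵤ p∣A) (∣⇒∣ᵤ p∣B)) (∣⇒∣ᵤ p∣C)

  euclidsLemmaℤ : ∀ i j {p} → Prime p → + p ∣ i * j → (+ p ∣ i) ⊎ (+ p ∣ j)
  euclidsLemmaℤ i j {p} p-prime p∣ij = Sum.map ∣ᵤ⇒∣ ∣ᵤ⇒∣
    (euclidsLemma ∣ i ∣ ∣ j ∣ p-prime (subst (p ℕᵈ.∣_) (abs-* i j) (∣⇒∣ᵤ p∣ij)))

  p∣H⇒p∣w : ∀ {p H} → Prime p → ¬ DividesAllValues p H →
    (R : ℤ² → ℤ) (K : ℤ) (w : ℤ² → ℤ) → (∀ z → H ⟦ z ⟧ ≡ + p * R z + K * (w z * w z)) →
    ∀ z → + p ∣ H ⟦ z ⟧ → + p ∣ w z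
  p∣H⇒p∣w {p} p-prime ¬p∣H R K w split z p∣H[z]
    with euclidsLemmaℤ K (w z * w z) p-prime
           (∣m+n∣m⇒∣n (subst (+ p ∣_) (split z) p∣H[z]) (∣m⇒∣m*n (R z) ∣-refl))
  ... | inj₁ p∣K  = ⊥-elim (¬p∣H λ z → subst (+ p ∣_) (sym (split z))
                      (∣m∣n⇒∣m+n (∣m⇒∣m*n (R z) ∣-refl) (∣m⇒∣m*n _ p∣K)))
  ... | inj₂ p∣w² = Sum.reduce (euclidsLemmaℤ (w z) (w z) p-prime p∣w²)

  -- psi-head p F (x , y) = F (x , p y)   and   psi-shift p h F (x , y) = F (p x + h y , y).
  psi-head : ℕ → Form → Form
  psi-head p (form a b c) = form a (b * + p) (c * + p * + p)

  psi-shift : ℕ → ℕ → Form → Form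
  psi-shift p h (form a b c) =
    form (a * + p * + p) (+ p * b + + 2 * a * + h * + p) (a * + h * + h + b * + h + c)

  psi-head-embedding : ∀ {p} F → Prime p → ¬ DividesAllValues p (psi-head p F) →
    ScaledEmbedding p F (psi-head p F)
  psi-head-embedding {p} (form a b c) p-prime ¬p∣H = record
    { ι         = ι
    ; injective = injective
    ; scales    = λ (s , t) → scaling a b c (+ p) s t
    ; covers-p∣ = covers
    }
    where
    instance
      p≢0 : ℤ.NonZero (+ p)
      p≢0 = prime⇒nonZero p-prime
    scaling : ∀ a b c P s t →
      a * (P * s) * (P * s) + b * P * (P * s) * t + c * P * P * t * t ≡
      P * P * (a * s * s + b * s * t + c * t * t)
    scaling = solve-∀
    split : ∀ a b c P u v →
      a * u * u + b * P * u * v + c * P * P * v * v ≡ P * (b * u * v + c * P * v * v) + a * (u * u)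
    split = solve-∀
    ι : ℤ² → ℤ²
    ι (s , t) = + p * s , t
    injective : Injective _≡_ _≡_ ι
    injective eq = cong₂ _,_ (*-cancelˡ-≡ (+ p) _ _ (proj₁ (,-injective eq))) (proj₂ (,-injective eq))
    p∣u : ∀ u v → + p ∣ psi-head p (form a b c) ⟦ (u , v) ⟧ → + p ∣ u
    p∣u u v = p∣H⇒p∣w {H = psi-head p (form a b c)} p-prime ¬p∣H
      (λ (u , v) → b * u * v + c * + p * v * v) a proj₁ (λ (u , v) → split a b c (+ p) u v) (u , v)
    covers : ∀ w → + p ∣ psi-head p (form a b c) ⟦ w ⟧ → ∃ λ z → ι z ≡ w
    covers (u , v) p∣H[u,v] = let divides q u≡qp = p∣u u v p∣H[u,v] in
      (q , v) , cong (_, v) (trans (*-comm (+ p) q) (sym u≡qp))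

  psi-shift-embedding : ∀ {p} h F → Prime p → ¬ DividesAllValues p (psi-shift p h F) →
    ScaledEmbedding p F (psi-shift p h F)
  psi-shift-embedding {p} h (form a b c) p-prime ¬p∣H = record
    { ι         = ι
    ; injective = injective
    ; scales    = λ (s , t) → scaling a b c (+ p) (+ h) s t
    ; covers-p∣ = covers
    }
    where
    instance
      p≢0 : ℤ.NonZero (+ p)
      p≢0 = prime⇒nonZero p-prime
    scaling : ∀ a b c P h s t →
      a * P * P * (s - h * t) * (s - h * t) + (P * b + + 2 * a * h * P) * (s - h * t) * (P * t) +
      (a * h * h + b * h + c) * (P * t) * (P * t) ≡ P * P * (a * s * s + b * s * t + c * t * t)
    scaling = solve-∀
    split : ∀ a b c P h u v →
      a * P * P * u * u + (P * b + + 2 * a * h * P) * u * v + (a * h * h + b * h + c) * v * v ≡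
      P * (a * P * u * u + (b + + 2 * a * h) * u * v) + (a * h * h + b * h + c) * (v * v)
    split = solve-∀
    shear : ∀ s h t → s - h * t + h * t ≡ s
    shear = solve-∀
    shear⁻¹ : ∀ u h q → u + h * q - h * q ≡ u
    shear⁻¹ = solve-∀
    ι : ℤ² → ℤ²
    ι (s , t) = s - + h * t , + p * t
    injective : Injective _≡_ _≡_ ι
    injective {s , t} {s′ , t′} eq = cong₂ _,_ s≡s′ t≡t′
      where
      t≡t′ = *-cancelˡ-≡ (+ p) t t′ (proj₂ (,-injective eq))
      s≡s′ = trans (sym (shear s (+ h) t))
        (trans (cong₂ (λ x y → x + + h * y) (proj₁ (,-injective eq)) t≡t′) (shear s′ (+ h) t′))
    p∣v : ∀ u v → + p ∣ psi-shift p h (form a b c) ⟦ (u , v) ⟧ → + p ∣ v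
    p∣v u v = p∣H⇒p∣w {H = psi-shift p h (form a b c)} p-prime ¬p∣H
      (λ (u , v) → a * + p * u * u + (b + + 2 * a * + h) * u * v) (a * + h * + h + b * + h + c) proj₂
      (λ (u , v) → split a b c (+ p) (+ h) u v) (u , v)
    covers : ∀ w → + p ∣ psi-shift p h (form a b c) ⟦ w ⟧ → ∃ λ z → ι z ≡ w
    covers (u , v) p∣H[u,v] = let divides q v≡qp = p∣v u v p∣H[u,v] in
      (u + + h * q , q) , cong₂ _,_ (shear⁻¹ u (+ h) q) (trans (*-comm (+ p) q) (sym v≡qp))

  psiList⇒ScaledEmbedding : ∀ {p F H} → Prime p → H ∈ psiList p F → ¬ DividesAllValues p H →
    ScaledEmbedding p F H
  psiList⇒ScaledEmbedding {F = F@(form _ _ _)} p-prime (here refl) = psi-head-embedding F p-prime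
  psiList⇒ScaledEmbedding {F = F@(form _ _ _)} p-prime (there H∈) with ∈-map⁻ _ H∈
  ... | h , _ , refl = psi-shift-embedding h F p-prime

  InPsi⇒ScaledEmbedding : ∀ {p F G} → Prime p → InPsi p F G → ScaledEmbedding p F G
  InPsi⇒ScaledEmbedding {p} {F} {G} p-prime (G-primitive , H , H∈ , H~G) =
    ScaledEmbedding-respʳ-~ {p} {F} {H} {G} (psiList⇒ScaledEmbedding p-prime H∈ ¬p∣H) H~G
    where
    ¬p∣H : ¬ DividesAllValues p H
    ¬p∣H = primitive⇒¬DividesAllValues {p} {G} p-prime G-primitive
         ∘ DividesAllValues-respʳ-~ {p} {H} {G} H~G

open Representation using (i<0⇒i*+n<0; Pop-theta≡subQ-theta; InPsi⇒ScaledEmbedding)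

open import Data.Nat using (ℕ; _*_)
open import Data.Nat.Primality using (Prime; prime⇒nonZero)
open import Data.Nat.Properties using (m*n≢0)
open import Data.Integer using (ℤ; +_; _<_) renaming (_*_ to _*ℤ_)
open import Relation.Binary.PropositionalEquality using (_≡_; refl; sym; subst)

lemma4p6 : (Δ : ℤ) (p : ℕ) (pp : Prime p) (F G : Form) →
    Δ < + 0 →
    + 0 < a F → disc F ≡ Δ → Primitive F →
    + 0 < a G → disc G ≡ Δ *ℤ + (p * p) → Primitive G →
    InPsi p F G →
    ∀ n → Pop p 0 {{prime⇒nonZero pp}} (theta G) n
          ≡ subQ (p * p) {{m*n≢0 p p {{prime⇒nonZero pp}} {{prime⇒nonZero pp}}}} (theta F) n
lemma4p6 Δ p pp F G Δ<0 _ refl _ _ ΔG≡Δp² _ G∈Ψ =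
  Pop-theta≡subQ-theta {p} {F} {G} (InPsi⇒ScaledEmbedding pp G∈Ψ) Δ<0 ΔG<0
  where
  instance
    p≢0 = prime⇒nonZero pp
  ΔG<0 = subst (_< + 0) (sym ΔG≡Δp²) (i<0⇒i*+n<0 (p * p) {{m*n≢0 p p}} Δ<0)
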